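{- Let $(\Delta^{\mathcal T}_{\mathcal R},\Delta^{\mathcal T}_{\mathcal R'})$ be one of the following source/target pairs: $(\Delta^{\rm CD}_{\equiv},\Delta^{\rm CD}_{=_\beta})$, $(\Delta^{\rm CDV}_{\equiv},\Delta^{\rm CDV}_{=_{\beta\eta}})$, $(\Delta^{\rm CDS}_{\equiv},\Delta^{\rm CDS}_{=_\beta})$, $(\Delta^{\rm BCD}_{\equiv},\Delta^{\rm BCD}_{=_{\beta\eta}})$, $(\Delta^{\rm CD}_{=_\beta},\Delta^{\rm CD}_{=_\beta})$, $(\Delta^{\rm CDV}_{=_\beta},\Delta^{\rm CDV}_{=_{\beta\eta}})$, $(\Delta^{\rm CDS}_{=_\beta},\Delta^{\rm CDS}_{=_\beta})$, $(\Delta^{\rm BCD}_{=_\beta},\Delta^{\rm BCD}_{=_{\beta\eta}})$, $(\Delta^{\rm CDV}_{=_{\beta\eta}},\Delta^{\rm CDV}_{=_{\beta\eta}})$, $(\Delta^{\rm BCD}_{=_{\beta\eta}},\Delta^{\rm BCD}_{=_{\beta\eta}})$. If $B\vdash^{\mathcal T}_{\mathcal R}\Delta:\sigma$, then $B\vdash^{\mathcal T}_{\mathcal R'}[\Delta]_B:\sigma$ and $\lfloor[\Delta]_B\rfloor\,\mathcal R'\,\lfloor\Delta\rfloor$.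
   Context: Types: $\mathbb A_\infty=\{a_i\mid i\in\mathbb N\}$, $\omega$ special atom, $\mathbb A^\omega_\infty=\mathbb A_\infty\cup\{\omega\}$; types $\sigma::=\mathbb A\mid\sigma\to\sigma\mid\sigma\cap\sigma$. Minimal type theory: (refl) $\sigma\le\sigma$; (incl) $\sigma\cap\tau\le\sigma,\sigma\cap\tau\le\tau$; (glb) $\rho\le\sigma,\rho\le\tau\Rightarrow\rho\le\sigma\cap\tau$; (trans). Extras: $(\omega_{top})$ $\sigma\le\omega$; $(\omega_\to)$ $\omega\le\sigma\to\omega$; $(\to\cap)$ $(\sigma\to\tau)\cap(\sigma\to\rho)\le\sigma\to\tau\cap\rho$; $(\to)$ $\sigma_2\le\sigma_1,\tau_1\le\tau_2\Rightarrow\sigma_1\to\tau_1\le\sigma_2\to\tau_2$. $\mathcal T_{\rm CD}$: over $\mathbb A_\infty$, minimal; $\mathcal T_{\rm CDS}$: over $\mathbb A^\omega_\infty$ plus $(\omega_{top})$; $\mathcal T_{\rm CDV}$: over $\mathbb A_\infty$ plus $(\to),(\to\cap)$; $\mathcal T_{\rm BCD}$: over $\mathbb A^\omega_\infty$ plus all four extras. $\Delta$-terms: $\Delta::=u_\Delta\mid x\mid\lambda x{:}\sigma.\Delta\mid\Delta\,\Delta\mid\langle\Delta,\Delta\rangle\mid pr_i\Delta\mid\Delta^\sigma$, $u_\Delta$ a constant indexed by an arbitrary $\Delta$-term. Essence: $\lfloor x\rfloor=x$, $\lfloor u_\Delta\rfloor=\lfloor\Delta\rfloor$, $\lfloor\Delta^\sigma\rfloor=\lfloor\Delta\rfloor$,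 $\lfloor\lambda x{:}\sigma.\Delta\rfloor=\lambda x.\lfloor\Delta\rfloor$, $\lfloor\Delta_1\Delta_2\rfloor=\lfloor\Delta_1\rfloor\lfloor\Delta_2\rfloor$, $\lfloor\langle\Delta_1,\Delta_2\rangle\rfloor=\lfloor\Delta_1\rfloor$, $\lfloor pr_i\Delta\rfloor=\lfloor\Delta\rfloor$. Typed system $\Delta^{\mathcal T}_{\mathcal R}$ ($\mathcal R\in\{\equiv,=_\beta,=_{\beta\eta}\}$ on pure $\lambda$-terms): (top) $B\vdash u_\Delta:\omega$ if $\omega$ is an atom of $\mathcal T$; (ax) $B\vdash x:\sigma$ if $x{:}\sigma\in B$; ($\to I$) $B,x{:}\sigma\vdash\Delta:\tau\Rightarrow B\vdash\lambda x{:}\sigma.\Delta:\sigma\to\tau$; ($\to E$); ($\cap I$) from $B\vdash\Delta_1:\sigma$, $B\vdash\Delta_2:\tau$, $\lfloor\Delta_1\rfloor\mathcal R\lfloor\Delta_2\rfloor$ get $B\vdash\langle\Delta_1,\Delta_2\rangle:\sigma\cap\tau$; ($\cap E_i$) from $\Delta:\sigma\cap\tau$ get $pr_1\Delta:\sigma$, $pr_2\Delta:\tau$; ($\le_{\mathcal T}$) from $\Delta:\sigma$, $\sigma\le_{\mathcal T}\tau$ get $\Delta^\tau:\tau$. Coercion terms $[\sigma\le_{\mathcal T}\tau]$, by recursion on a derivation of $\sigma\le_{\mathcal T}\tau$: (refl) $\lambda x{:}\sigma.x$; (incl) $\lambda x{:}\sigma\cap\tau.pr_1x$ resp. $\lambda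 x{:}\sigma\cap\tau.pr_2x$; (glb) $[\rho\le\sigma\cap\tau]=\lambda x{:}\rho.\langle[\rho\le\sigma]x,[\rho\le\tau]x\rangle$; (trans) $[\sigma\le\rho]=\lambda x{:}\sigma.[\tau\le\rho]([\sigma\le\tau]x)$; $(\omega_{top})$ $\lambda x{:}\sigma.u_x$; $(\omega_\to)$ $\lambda f{:}\omega.\lambda x{:}\sigma.u_{(f\,x)}$; $(\to\cap)$ $\lambda f{:}(\sigma\to\tau)\cap(\sigma\to\rho).\lambda x{:}\sigma.\langle(pr_1f)x,(pr_2f)x\rangle$; $(\to)$ $[\sigma_1\to\tau_1\le\sigma_2\to\tau_2]=\lambda f{:}\sigma_1\to\tau_1.\lambda x{:}\sigma_2.[\tau_1\le\tau_2](f([\sigma_2\le\sigma_1]x))$. Translation $[\cdot]_B$: $[u_\Delta]_B=u_{[\Delta]_B}$; $[x]_B=x$; $[\lambda x{:}\sigma.\Delta]_B=\lambda x{:}\sigma.[\Delta]_{B,x{:}\sigma}$; $[\Delta_1\Delta_2]_B=[\Delta_1]_B[\Delta_2]_B$; $[\langle\Delta_1,\Delta_2\rangle]_B=\langle[\Delta_1]_B,[\Delta_2]_B\rangle$; $[pr_i\Delta]_B=pr_i[\Delta]_B$; $[\Delta^\tau]_B=[\sigma\le_{\mathcal T}\tau]\,[\Delta]_B$ where $B\vdash^{\mathcal T}_{\mathcal R}\Delta:\sigma$. -}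

module Defs where

open import Data.Nat using (ℕ; zero; suc; _<ᵇ_; _≡ᵇ_; _∸_)
open import Data.Bool using (if_then_else_)
open import Data.List using (List; []; _∷_)
open import Data.Unit using (⊤)
open import Data.Empty using (⊥)
open import Data.Product using (_×_)
open import Relation.Binary.PropositionalEquality using (_≡_)

data Λ : Set where
  var : ℕ → Λ
  lam : Λ → Λ
  app : Λ → Λ → Λ

shift : ℕ → Λ → Λ
shift c (var n) = if n <ᵇ c then var n else var (suc n)
shift c (lam M) = lam (shift (suc c) M)
shift c (app M N) = app (shift c M) (shift c N)

subst : ℕ → Λ → Λ → Λ
subst j N (var n) =
  if n ≡ᵇ j then N else (if n <ᵇ j then var n else var (n ∸ 1))
subst j N (lam M) = lam (subst (suc j) (shift 0 N) M)
subst j N (app M M') = app (subst j N M) (subst j N M')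

data _→β_ : Λ → Λ → Set where
  β    : ∀ {M N} → app (lam M) N →β subst 0 N M
  ξlam : ∀ {M M'} → M →β M' → lam M →β lam M'
  ξapL : ∀ {M M' N} → M →β M' → app M N →β app M' N
  ξapR : ∀ {M N N'} → N →β N' → app M N →β app M N'

data _→βη_ : Λ → Λ → Set where
  β    : ∀ {M N} → app (lam M) N →βη subst 0 N M
  η    : ∀ {M} → lam (app (shift 0 M) (var 0)) →βη M
  ξlam : ∀ {M M'} → M →βη M' → lam M →βη lam M'
  ξapL : ∀ {M M' N} → M →βη M' → app M N →βη app M' N
  ξapR : ∀ {M N N'} → N →βη N' → app M N →βη app M N'

data EqClo (S : Λ → Λ → Set) : Λ → Λ → Set where
  step  : ∀ {M N} → S M N → EqClo S M N
  rfl   : ∀ {M} → EqClo S M M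
  sym   : ∀ {M N} → EqClo S M N → EqClo S N M
  trans : ∀ {M N P} → EqClo S M N → EqClo S N P → EqClo S M P

_=β_ : Λ → Λ → Set
_=β_ = EqClo _→β_

_=βη_ : Λ → Λ → Set
_=βη_ = EqClo _→βη_

data Rel : Set where
  syn beta betaeta : Rel

⟦_⟧ : Rel → Λ → Λ → Set
⟦ syn ⟧ = _≡_
⟦ beta ⟧ = _=β_
⟦ betaeta ⟧ = _=βη_

data Theory : Set where
  CD CDS CDV BCD : Theory

-- theories over A^ω_∞ (these are also exactly the ones with (ω_top))
HasΩ : Theory → Set
HasΩ CDS = ⊤
HasΩ BCD = ⊤
HasΩ _   = ⊥

HasArr : Theory → Set
HasArr CDV = ⊤
HasArr BCD = ⊤
HasArr _   = ⊥

HasΩArr : Theory → Set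
HasΩArr BCD = ⊤
HasΩArr _   = ⊥

infixr 7 _⇒_
infixl 8 _∩_

data Type (T : Theory) : Set where
  at  : ℕ → Type T
  ω   : HasΩ T → Type T
  _⇒_ : Type T → Type T → Type T
  _∩_ : Type T → Type T → Type T

infix 4 _⊢_≤_
data _⊢_≤_ (T : Theory) : Type T → Type T → Set where
  refl  : ∀ {σ} → T ⊢ σ ≤ σ
  incl₁ : ∀ {σ τ} → T ⊢ σ ∩ τ ≤ σ
  incl₂ : ∀ {σ τ} → T ⊢ σ ∩ τ ≤ τ
  glb   : ∀ {ρ σ τ} → T ⊢ ρ ≤ σ → T ⊢ ρ ≤ τ → T ⊢ ρ ≤ σ ∩ τ
  trans : ∀ {σ τ ρ} → T ⊢ σ ≤ τ → T ⊢ τ ≤ ρ → T ⊢ σ ≤ ρ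
  ωtop  : ∀ {σ} (p : HasΩ T) → T ⊢ σ ≤ ω p
  ω→    : ∀ {σ} (p : HasΩ T) → HasΩArr T → T ⊢ ω p ≤ σ ⇒ ω p
  →∩    : ∀ {σ τ ρ} → HasArr T → T ⊢ (σ ⇒ τ) ∩ (σ ⇒ ρ) ≤ σ ⇒ τ ∩ ρ
  arr   : ∀ {σ₁ σ₂ τ₁ τ₂} → HasArr T →
          T ⊢ σ₂ ≤ σ₁ → T ⊢ τ₁ ≤ τ₂ → T ⊢ σ₁ ⇒ τ₁ ≤ σ₂ ⇒ τ₂

data Term (T : Theory) : Set where
  u    : Term T → Term T
  var  : ℕ → Term T
  lam  : Type T → Term T → Term T
  app  : Term T → Term T → Term T
  pair : Term T → Term T → Term T
  pr₁  : Term T → Term T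
  pr₂  : Term T → Term T
  _^_  : Term T → Type T → Term T

⌊_⌋ : ∀ {T} → Term T → Λ
⌊ u Δ ⌋ = ⌊ Δ ⌋
⌊ var n ⌋ = var n
⌊ lam σ Δ ⌋ = lam ⌊ Δ ⌋
⌊ app Δ₁ Δ₂ ⌋ = app ⌊ Δ₁ ⌋ ⌊ Δ₂ ⌋
⌊ pair Δ₁ Δ₂ ⌋ = ⌊ Δ₁ ⌋
⌊ pr₁ Δ ⌋ = ⌊ Δ ⌋
⌊ pr₂ Δ ⌋ = ⌊ Δ ⌋
⌊ Δ ^ σ ⌋ = ⌊ Δ ⌋

-- bases: B , x:σ is σ ∷ B, variable n refers to the n-th entry
Ctx : Theory → Set
Ctx T = List (Type T)

data _∋_∶_ {T : Theory} : Ctx T → ℕ → Type T → Set where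
  here  : ∀ {B σ} → (σ ∷ B) ∋ zero ∶ σ
  there : ∀ {B σ τ n} → B ∋ n ∶ σ → (τ ∷ B) ∋ suc n ∶ σ

infix 4 _⊢[_]_∶_ _∋_∶_
data _⊢[_]_∶_ {T : Theory} (B : Ctx T) (R : Rel) : Term T → Type T → Set where
  top  : ∀ {Δ} (p : HasΩ T) → B ⊢[ R ] u Δ ∶ ω p
  ax   : ∀ {n σ} → B ∋ n ∶ σ → B ⊢[ R ] var n ∶ σ
  →I   : ∀ {σ τ Δ} → (σ ∷ B) ⊢[ R ] Δ ∶ τ → B ⊢[ R ] lam σ Δ ∶ σ ⇒ τ
  →E   : ∀ {σ τ Δ₁ Δ₂} → B ⊢[ R ] Δ₁ ∶ σ ⇒ τ → B ⊢[ R ] Δ₂ ∶ σ →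
         B ⊢[ R ] app Δ₁ Δ₂ ∶ τ
  ∩I   : ∀ {σ τ Δ₁ Δ₂} → B ⊢[ R ] Δ₁ ∶ σ → B ⊢[ R ] Δ₂ ∶ τ →
         ⟦ R ⟧ ⌊ Δ₁ ⌋ ⌊ Δ₂ ⌋ → B ⊢[ R ] pair Δ₁ Δ₂ ∶ σ ∩ τ
  ∩E₁  : ∀ {σ τ Δ} → B ⊢[ R ] Δ ∶ σ ∩ τ → B ⊢[ R ] pr₁ Δ ∶ σ
  ∩E₂  : ∀ {σ τ Δ} → B ⊢[ R ] Δ ∶ σ ∩ τ → B ⊢[ R ] pr₂ Δ ∶ τ
  ≤T   : ∀ {σ τ Δ} → B ⊢[ R ] Δ ∶ σ → T ⊢ σ ≤ τ → B ⊢[ R ] Δ ^ τ ∶ τ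

coe : ∀ {T σ τ} → T ⊢ σ ≤ τ → Term T
coe {σ = σ} refl = lam σ (var 0)
coe {σ = σ} incl₁ = lam σ (pr₁ (var 0))
coe {σ = σ} incl₂ = lam σ (pr₂ (var 0))
coe {σ = ρ} (glb d₁ d₂) = lam ρ (pair (app (coe d₁) (var 0)) (app (coe d₂) (var 0)))
coe {σ = σ} (trans d₁ d₂) = lam σ (app (coe d₂) (app (coe d₁) (var 0)))
coe {σ = σ} (ωtop p) = lam σ (u (var 0))
coe {τ = σ ⇒ _} (ω→ p _) = lam (ω p) (lam σ (u (app (var 1) (var 0))))
coe {σ = (σ ⇒ τ) ∩ (σ ⇒ ρ)} (→∩ _) =
  lam ((σ ⇒ τ) ∩ (σ ⇒ ρ))
      (lam σ (pair (app (pr₁ (var 1)) (var 0)) (app (pr₂ (var 1)) (var 0))))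
coe {σ = σ₁ ⇒ τ₁} {τ = σ₂ ⇒ τ₂} (arr _ d₁ d₂) =
  lam (σ₁ ⇒ τ₁) (lam σ₂ (app (coe d₂) (app (var 1) (app (coe d₁) (var 0)))))

-- Translation [Δ]_B, as a relation  Tr R B Δ Δ'  ("Δ' is [Δ]_B"):
-- the only non-determinism is the choice of the derivation of σ ≤_T τ
-- (and of the typing B ⊢^T_R Δ : σ) in the Δ^τ clause.

data Tr {T : Theory} (R : Rel) : Ctx T → Term T → Term T → Set where
  u    : ∀ {B Δ Δ'} → Tr R B Δ Δ' → Tr R B (u Δ) (u Δ')
  var  : ∀ {B n} → Tr R B (var n) (var n)
  lam  : ∀ {B σ Δ Δ'} → Tr R (σ ∷ B) Δ Δ' → Tr R B (lam σ Δ) (lam σ Δ')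
  app  : ∀ {B Δ₁ Δ₁' Δ₂ Δ₂'} → Tr R B Δ₁ Δ₁' → Tr R B Δ₂ Δ₂' →
         Tr R B (app Δ₁ Δ₂) (app Δ₁' Δ₂')
  pair : ∀ {B Δ₁ Δ₁' Δ₂ Δ₂'} → Tr R B Δ₁ Δ₁' → Tr R B Δ₂ Δ₂' →
         Tr R B (pair Δ₁ Δ₂) (pair Δ₁' Δ₂')
  pr₁  : ∀ {B Δ Δ'} → Tr R B Δ Δ' → Tr R B (pr₁ Δ) (pr₁ Δ')
  pr₂  : ∀ {B Δ Δ'} → Tr R B Δ Δ' → Tr R B (pr₂ Δ) (pr₂ Δ')
  coer : ∀ {B Δ Δ' σ τ} → B ⊢[ R ] Δ ∶ σ → (d : T ⊢ σ ≤ τ) →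
         Tr R B Δ Δ' → Tr R B (Δ ^ τ) (app (coe d) Δ')

data ValidPair : Theory → Rel → Rel → Set where
  cd-≡     : ValidPair CD  syn beta
  cdv-≡    : ValidPair CDV syn betaeta
  cds-≡    : ValidPair CDS syn beta
  bcd-≡    : ValidPair BCD syn betaeta
  cd-β     : ValidPair CD  beta beta
  cdv-β    : ValidPair CDV beta betaeta
  cds-β    : ValidPair CDS beta beta
  bcd-β    : ValidPair BCD beta betaeta
  cdv-βη   : ValidPair CDV betaeta betaeta
  bcd-βη   : ValidPair BCD betaeta betaeta

-- The essence of a coercion [σ ≤ τ] is a closed term which, applied to any M, is R'-equal
-- to M.  For (→), (→∩) and (ω_→) that essence is λf.λx.f x, so η is needed; these rules
-- occur only in the theories whose target relation is =βη.  Hence ⌊[Δ]_B⌋ R' ⌊Δ⌋, and as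
-- R ⊆ R' the side condition of every (∩I), including those inside the (glb) and (→∩)
-- coercions, survives the translation.
module Submission where

open import Defs
open import Data.Nat using (suc)
open import Data.Product using (_×_; _,_)
open import Relation.Binary.Bundles using (Setoid)
open import Relation.Binary.Structures using (IsEquivalence)
open import Relation.Binary.PropositionalEquality as ≡ using (_≡_)

EqClo-map : ∀ {S S' : Λ → Λ → Set} (f : Λ → Λ) →
            (∀ {M N} → S M N → S' (f M) (f N)) →
            ∀ {M N} → EqClo S M N → EqClo S' (f M) (f N)
EqClo-map f h (step s)     = step (h s)
EqClo-map f h rfl          = rfl
EqClo-map f h (sym e)      = sym (EqClo-map f h e)
EqClo-map f h (trans e e') = trans (EqClo-map f h e) (EqClo-map f h e')

EqClo-isEquivalence : ∀ {S : Λ → Λ → Set} → IsEquivalence (EqClo S)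
EqClo-isEquivalence = record { refl = rfl ; sym = sym ; trans = trans }

→β⇒→βη : ∀ {M N} → M →β N → M →βη N
→β⇒→βη β        = β
→β⇒→βη (ξlam s) = ξlam (→β⇒→βη s)
→β⇒→βη (ξapL s) = ξapL (→β⇒→βη s)
→β⇒→βη (ξapR s) = ξapR (→β⇒→βη s)

≡⇒EqClo : ∀ {S : Λ → Λ → Set} {M N} → M ≡ N → EqClo S M N
≡⇒EqClo ≡.refl = rfl

=β⇒=βη : ∀ {M N} → M =β N → M =βη N
=β⇒=βη = EqClo-map (λ M → M) →β⇒→βη

record IsLambdaTheory (_≈_ : Λ → Λ → Set) : Set where
  field
    isEquivalence : IsEquivalence _≈_
    lam-cong      : ∀ {M N} → M ≈ N → lam M ≈ lam N
    app-cong      : ∀ {M M' N N'} → M ≈ M' → N ≈ N' → app M N ≈ app M' N'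
    →β⊆           : ∀ {M N} → M →β N → M ≈ N

  open IsEquivalence isEquivalence public
    renaming (refl to ≈-refl; sym to ≈-sym; trans to ≈-trans)

  setoid : Setoid _ _
  setoid = record { isEquivalence = isEquivalence }

Extensional : (Λ → Λ → Set) → Set
Extensional _≈_ = ∀ {M} → lam (app (shift 0 M) (var 0)) ≈ M

EqClo-isLambdaTheory : ∀ {S : Λ → Λ → Set} →
  (∀ {M N} → S M N → S (lam M) (lam N)) →
  (∀ {M M' N} → S M M' → S (app M N) (app M' N)) →
  (∀ {M N N'} → S N N' → S (app M N) (app M N')) →
  (∀ {M N} → M →β N → S M N) → IsLambdaTheory (EqClo S)
EqClo-isLambdaTheory ξlam' ξapL' ξapR' β⊆ = record
  { isEquivalence = EqClo-isEquivalence
  ; lam-cong      = EqClo-map lam ξlam'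
  ; app-cong      = λ {_} {_} {N} e e' →
                      trans (EqClo-map (λ X → app X N) ξapL' e) (EqClo-map (app _) ξapR' e')
  ; →β⊆           = λ s → step (β⊆ s)
  }

=β-isLambdaTheory : IsLambdaTheory _=β_
=β-isLambdaTheory = EqClo-isLambdaTheory ξlam ξapL ξapR (λ s → s)

=βη-isLambdaTheory : IsLambdaTheory _=βη_
=βη-isLambdaTheory = EqClo-isLambdaTheory ξlam ξapL ξapR →β⇒→βη

=βη-extensional : Extensional _=βη_
=βη-extensional = step η

subst-⌊coe⌋ : ∀ {T σ τ} (d : T ⊢ σ ≤ τ) j N → subst j N ⌊ coe d ⌋ ≡ ⌊ coe d ⌋
subst-⌊coe⌋ refl          j N = ≡.refl
subst-⌊coe⌋ incl₁         j N = ≡.refl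
subst-⌊coe⌋ incl₂         j N = ≡.refl
subst-⌊coe⌋ (glb d _)     j N =
  ≡.cong (λ C → lam (app C (var 0))) (subst-⌊coe⌋ d (suc j) (shift 0 N))
subst-⌊coe⌋ (trans d₁ d₂) j N =
  ≡.cong₂ (λ C₁ C₂ → lam (app C₂ (app C₁ (var 0))))
          (subst-⌊coe⌋ d₁ (suc j) (shift 0 N)) (subst-⌊coe⌋ d₂ (suc j) (shift 0 N))
subst-⌊coe⌋ (ωtop _)      j N = ≡.refl
subst-⌊coe⌋ (ω→ _ _)      j N = ≡.refl
subst-⌊coe⌋ (→∩ _)        j N = ≡.refl
subst-⌊coe⌋ (arr _ d₁ d₂) j N =
  ≡.cong₂ (λ C₁ C₂ → lam (lam (app C₂ (app (var 1) (app C₁ (var 0))))))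
          (subst-⌊coe⌋ d₁ (suc (suc j)) (shift 0 (shift 0 N)))
          (subst-⌊coe⌋ d₂ (suc (suc j)) (shift 0 (shift 0 N)))

HasΩArr⇒HasArr : ∀ {T} → HasΩArr T → HasArr T
HasΩArr⇒HasArr {BCD} _ = _

module Translation {T : Theory} {R' : Rel}
                   (isλ : IsLambdaTheory ⟦ R' ⟧)
                   (extensional : HasArr T → Extensional ⟦ R' ⟧) where

  open IsLambdaTheory isλ
  open import Relation.Binary.Reasoning.Setoid setoid

  β-≡ : ∀ {M N N'} → M →β N → N ≡ N' → ⟦ R' ⟧ M N'
  β-≡ s ≡.refl = →β⊆ s

  coe-essence-identity : ∀ {σ τ} (d : T ⊢ σ ≤ τ) M → ⟦ R' ⟧ (app ⌊ coe d ⌋ M) M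
  coe-essence-identity refl     M = →β⊆ β
  coe-essence-identity incl₁    M = →β⊆ β
  coe-essence-identity incl₂    M = →β⊆ β
  coe-essence-identity (ωtop _) M = →β⊆ β
  coe-essence-identity (glb d d') M = begin
    app ⌊ coe (glb d d') ⌋ M ≈⟨ β-≡ β (≡.cong (λ C → app C M) (subst-⌊coe⌋ d 0 M)) ⟩
    app ⌊ coe d ⌋ M          ≈⟨ coe-essence-identity d M ⟩
    M                        ∎
  coe-essence-identity (trans d₁ d₂) M = begin
    app ⌊ coe (trans d₁ d₂) ⌋ M
      ≈⟨ β-≡ β (≡.cong₂ (λ C₁ C₂ → app C₂ (app C₁ M)) (subst-⌊coe⌋ d₁ 0 M) (subst-⌊coe⌋ d₂ 0 M)) ⟩
    app ⌊ coe d₂ ⌋ (app ⌊ coe d₁ ⌋ M)  ≈⟨ app-cong ≈-refl (coe-essence-identity d₁ M) ⟩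
    app ⌊ coe d₂ ⌋ M                   ≈⟨ coe-essence-identity d₂ M ⟩
    M                                  ∎
  coe-essence-identity (ω→ _ h) M = ≈-trans (→β⊆ β) (extensional (HasΩArr⇒HasArr h))
  coe-essence-identity (→∩ h)   M = ≈-trans (→β⊆ β) (extensional h)
  coe-essence-identity (arr h d₁ d₂) M = begin
    app ⌊ coe (arr h d₁ d₂) ⌋ M
      ≈⟨ β-≡ β (≡.cong₂ (λ C₁ C₂ → lam (app C₂ (app M' (app C₁ (var 0)))))
                        (subst-⌊coe⌋ d₁ 1 M') (subst-⌊coe⌋ d₂ 1 M')) ⟩
    lam (app ⌊ coe d₂ ⌋ (app M' (app ⌊ coe d₁ ⌋ (var 0))))
      ≈⟨ lam-cong (coe-essence-identity d₂ _) ⟩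
    lam (app M' (app ⌊ coe d₁ ⌋ (var 0)))
      ≈⟨ lam-cong (app-cong ≈-refl (coe-essence-identity d₁ (var 0))) ⟩
    lam (app M' (var 0))  ≈⟨ extensional h ⟩
    M                     ∎
    where M' = shift 0 M

  coe-typed : ∀ {B : Ctx T} {σ τ} (d : T ⊢ σ ≤ τ) → B ⊢[ R' ] coe d ∶ σ ⇒ τ
  coe-typed refl          = →I (ax here)
  coe-typed incl₁         = →I (∩E₁ (ax here))
  coe-typed incl₂         = →I (∩E₂ (ax here))
  coe-typed (glb d₁ d₂)   =
    →I (∩I (→E (coe-typed d₁) (ax here)) (→E (coe-typed d₂) (ax here))
           (≈-trans (coe-essence-identity d₁ (var 0)) (≈-sym (coe-essence-identity d₂ (var 0)))))
  coe-typed (trans d₁ d₂) = →I (→E (coe-typed d₂) (→E (coe-typed d₁) (ax here)))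
  coe-typed (ωtop p)      = →I (top p)
  coe-typed (ω→ p _)      = →I (→I (top p))
  coe-typed (→∩ _)        =
    →I (→I (∩I (→E (∩E₁ (ax (there here))) (ax here))
               (→E (∩E₂ (ax (there here))) (ax here))
               ≈-refl))
  coe-typed (arr _ d₁ d₂) =
    →I (→I (→E (coe-typed d₂) (→E (ax (there here)) (→E (coe-typed d₁) (ax here)))))

  Tr-essence : ∀ {R} {B : Ctx T} {Δ Δ'} → Tr R B Δ Δ' → ⟦ R' ⟧ ⌊ Δ' ⌋ ⌊ Δ ⌋
  Tr-essence (u t)        = Tr-essence t
  Tr-essence var          = ≈-refl
  Tr-essence (lam t)      = lam-cong (Tr-essence t)
  Tr-essence (app t t')   = app-cong (Tr-essence t) (Tr-essence t')
  Tr-essence (pair t _)   = Tr-essence t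
  Tr-essence (pr₁ t)      = Tr-essence t
  Tr-essence (pr₂ t)      = Tr-essence t
  Tr-essence (coer {Δ' = Δ'} _ d t) = ≈-trans (coe-essence-identity d ⌊ Δ' ⌋) (Tr-essence t)

  Tr-typed : ∀ {R} → (∀ {M N} → ⟦ R ⟧ M N → ⟦ R' ⟧ M N) →
             ∀ {B : Ctx T} {Δ Δ' σ} → B ⊢[ R ] Δ ∶ σ → Tr R B Δ Δ' → B ⊢[ R' ] Δ' ∶ σ
  Tr-typed R⊆R' (top p)      (u t)       = top p
  Tr-typed R⊆R' (ax x)       var         = ax x
  Tr-typed R⊆R' (→I h)       (lam t)     = →I (Tr-typed R⊆R' h t)
  Tr-typed R⊆R' (→E h h')    (app t t')  = →E (Tr-typed R⊆R' h t) (Tr-typed R⊆R' h' t')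
  Tr-typed R⊆R' (∩I h h' e)  (pair t t') =
    ∩I (Tr-typed R⊆R' h t) (Tr-typed R⊆R' h' t')
       (≈-trans (Tr-essence t) (≈-trans (R⊆R' e) (≈-sym (Tr-essence t'))))
  Tr-typed R⊆R' (∩E₁ h)      (pr₁ t)     = ∩E₁ (Tr-typed R⊆R' h t)
  Tr-typed R⊆R' (∩E₂ h)      (pr₂ t)     = ∩E₂ (Tr-typed R⊆R' h t)
  Tr-typed R⊆R' (≤T _ _)     (coer h d t) = →E (coe-typed d) (Tr-typed R⊆R' h t)

  translation-sound : ∀ {R} → (∀ {M N} → ⟦ R ⟧ M N → ⟦ R' ⟧ M N) →
    ∀ {B : Ctx T} {Δ Δ' σ} → B ⊢[ R ] Δ ∶ σ → Tr R B Δ Δ' →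
    (B ⊢[ R' ] Δ' ∶ σ) × ⟦ R' ⟧ ⌊ Δ' ⌋ ⌊ Δ ⌋
  translation-sound R⊆R' h t = Tr-typed R⊆R' h t , Tr-essence t

open Translation using (translation-sound)

theorem5p7 : ∀ {T R R'} → ValidPair T R R' →
    ∀ {B : Ctx T} {Δ Δ' : Term T} {σ : Type T} →
    B ⊢[ R ] Δ ∶ σ → Tr R B Δ Δ' →
    (B ⊢[ R' ] Δ' ∶ σ) × ⟦ R' ⟧ ⌊ Δ' ⌋ ⌊ Δ ⌋
theorem5p7 cd-≡   = translation-sound =β-isLambdaTheory  (λ ())                ≡⇒EqClo
theorem5p7 cdv-≡  = translation-sound =βη-isLambdaTheory (λ _ → =βη-extensional) ≡⇒EqClo
theorem5p7 cds-≡  = translation-sound =β-isLambdaTheory  (λ ())                ≡⇒EqClo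
theorem5p7 bcd-≡  = translation-sound =βη-isLambdaTheory (λ _ → =βη-extensional) ≡⇒EqClo
theorem5p7 cd-β   = translation-sound =β-isLambdaTheory  (λ ())                (λ e → e)
theorem5p7 cdv-β  = translation-sound =βη-isLambdaTheory (λ _ → =βη-extensional) =β⇒=βη
theorem5p7 cds-β  = translation-sound =β-isLambdaTheory  (λ ())                (λ e → e)
theorem5p7 bcd-β  = translation-sound =βη-isLambdaTheory (λ _ → =βη-extensional) =β⇒=βη
theorem5p7 cdv-βη = translation-sound =βη-isLambdaTheory (λ _ → =βη-extensional) (λ e → e)
theorem5p7 bcd-βη = translation-sound =βη-isLambdaTheory (λ _ → =βη-extensional) (λ e → e)
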